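{- Let $B$ be a non-empty finite set (i.e. in bijection with $\{n\in\mathbb{N}\mid n\leq p\}$ for some $p$) and $T$ a predicate on $B^*$. (i) Reasoning in a logic where the principle $D_S$ holds, for $S$ a class of formulas containing the arithmetical existentially quantified formulas over $T$, $T$ is productive if and only if $T$ has unbounded paths. (ii) Reasoning in a logic where the principle $C_S$ holds, for such a class $S$, $T$ is inductively barred if and only if $T$ is uniformly barred.
   Context: $B^*$ is the set of finite sequences over $B$; $\langle\rangle$ is the empty sequence, $u\star b$ the extension of $u$ by $b$, $|u|$ the length, $u'\leq_s u$ means $u'$ is a prefix of $u$. $T^{\downarrow}=\{u\mid\forall u'\leq_s u,\ u'\in T\}$ and $T^{\uparrow}=\{u\mid\exists u'\leq_s u,\ u'\in T\}$. The pruning of $T$ is the greatest predicate $X$ on $B^*$ with $X(u)\Rightarrow(u\in T\wedge\exists b\,X(u\star b))$; $T$ is productive if $\langle\rangle$ is in its pruning. The hereditary closure of $T$ is the least $X$ with $X(u)$ whenever $u\in T$ or $\forall b\,X(u\star b)$; $T$ is inductively barred if $\langle\rangle$ is in its hereditary closure. $T$ has unbounded paths if $\forall n\,\exists u\,(|u|=n\wedge u\in T^{\downarrow})$; $T$ is uniformly barred if $\exists n\,\forall u\,(|u|=n\Rightarrow u\in T^{\uparrow})$. For a class $S$ of formulas, $D_S$ is the principle $\forall x\,\forall y\,(P(x)\vee Q(y))\Rightarrow(\forall x\,P(x))\vee(\forall y\,Q(y))$ for $P,Q$ ranging over $S$, and $C_S$ is $(\exists x\,P(x))\wedge(\exists y\,Q(y))\Rightarrow\exists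 x\,\exists y\,(P(x)\wedge Q(y))$ for $P,Q$ in $S$. (Both hold in classical logic.) -}

module Defs where

open import Level using (Level; suc; zero)
open import Data.Nat using (ℕ)
open import Data.List using (List; []; _∷_; _++_; [_]; length)
open import Data.Product using (Σ; ∃; ∃-syntax; _×_; _,_)
open import Data.Sum using (_⊎_)
open import Data.Unit using (⊤)
open import Data.Empty using (⊥)
open import Relation.Binary.PropositionalEquality using (_≡_)

module _ {B : Set} where

  infixl 5 _⋆_
  _⋆_ : List B → B → List B
  u ⋆ b = u ++ [ b ]

  _≤s_ : List B → List B → Set
  u' ≤s u = ∃[ w ] (u' ++ w ≡ u)

  _↓ : (List B → Set) → List B → Set
  (T ↓) u = ∀ u' → u' ≤s u → T u'

  _↑ : (List B → Set) → List B → Set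
  (T ↑) u = ∃[ u' ] (u' ≤s u × T u')

  -- X is a post-fixed point of the pruning operator
  PruneClosed : (List B → Set) → (List B → Set) → Set
  PruneClosed T X = ∀ u → X u → T u × ∃[ b ] X (u ⋆ b)

  -- pruning of T : the greatest such X (union of all post-fixed points)
  Pruning : (List B → Set) → List B → Set₁
  Pruning T u = Σ (List B → Set) λ X → PruneClosed T X × X u

  Productive : (List B → Set) → Set₁
  Productive T = Pruning T []

  data HerClosure (T : List B → Set) : List B → Set where
    base : ∀ {u} → T u → HerClosure T u
    step : ∀ {u} → (∀ b → HerClosure T (u ⋆ b)) → HerClosure T u

  InductivelyBarred : (List B → Set) → Set
  InductivelyBarred T = HerClosure T []

  UnboundedPaths : (List B → Set) → Set
  UnboundedPaths T = ∀ (n : ℕ) → ∃[ u ] (length u ≡ n × (T ↓) u)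

  UniformlyBarred : (List B → Set) → Set
  UniformlyBarred T = ∃[ n ] (∀ u → length u ≡ n → (T ↑) u)

  data Form : Set where
    atom : List B → Form
    ⊤f ⊥f : Form
    _∧f_ _∨f_ _⇒f_ : Form → Form → Form

  ⟦_⟧ : Form → (List B → Set) → Set
  ⟦ atom u ⟧ T = T u
  ⟦ ⊤f ⟧ T = ⊤
  ⟦ ⊥f ⟧ T = ⊥
  ⟦ φ ∧f ψ ⟧ T = ⟦ φ ⟧ T × ⟦ ψ ⟧ T
  ⟦ φ ∨f ψ ⟧ T = ⟦ φ ⟧ T ⊎ ⟦ ψ ⟧ T
  ⟦ φ ⇒f ψ ⟧ T = ⟦ φ ⟧ T → ⟦ ψ ⟧ T

  -- the arithmetical existentially quantified (Σ⁰₁) formula over T with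
  -- free variable x : ℕ determined by a computable matrix φ :
  --   P x  =  ∃ y. φ(x,y)   where φ(x,y) is a boolean combination of atoms T(u)
  Σ₁ : (List B → Set) → (ℕ → ℕ → Form) → ℕ → Set
  Σ₁ T φ x = ∃[ y ] ⟦ φ x y ⟧ T

  D-Σ₁ : (List B → Set) → Set
  D-Σ₁ T = ∀ (φ ψ : ℕ → ℕ → Form) →
    (∀ x y → Σ₁ T φ x ⊎ Σ₁ T ψ y) → (∀ x → Σ₁ T φ x) ⊎ (∀ y → Σ₁ T ψ y)

  C-Σ₁ : (List B → Set) → Set
  C-Σ₁ T = ∀ (φ ψ : ℕ → ℕ → Form) →
    (∃[ x ] Σ₁ T φ x) × (∃[ y ] Σ₁ T ψ y) → ∃[ x ] ∃[ y ] (Σ₁ T φ x × Σ₁ T ψ y)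

-- (i) Along a prune-closed set one walks to paths of every length. Conversely,
-- call u unbounded if for every n it has an extension of length n all of whose
-- prefixes lie in T. The unbounded nodes are prune-closed as soon as some child
-- of an unbounded node is unbounded. For every length some child has an
-- extension of that length, and "u has an extension of length n" is Σ⁰₁ (the
-- extension is coded by a numeral) and down-closed in n; so D, extended to
-- finitely many Σ⁰₁ formulas, picks one child with extensions of all lengths.
--
-- (ii) Over a finitely branching tree an inductive bar is uniformly bounded by
-- induction on the bar, and a bar at a fixed depth n yields an inductive bar by
-- induction on n; this is constructive.
module Submission where

open import Defs
open import Data.Nat using (ℕ; suc; zero; _+_; _*_; _≤_; _⊔_; pred; s≤s; _/_; NonZero)
open import Data.Nat.Properties using (≤-refl; ≤-trans; m≤m⊔n; m≤n⊔m; m≤n⇒m⊓n≡m; +-comm)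
open import Data.Nat.DivMod using ([m+kn]%n≡m%n; m<n⇒m%n≡m; m%n<n; +-distrib-/-∣ʳ; m<n⇒m/n≡0; m*n/n≡m)
open import Data.Nat.Divisibility using (divides)
open import Data.Fin using (Fin; zero; suc; toℕ; fromℕ<)
open import Data.Fin.Properties using (toℕ<n; fromℕ<-toℕ; fromℕ<-cong; ∀-cons)
open import Data.List using (List; []; _∷_; _++_; [_]; length; take; drop; map)
open import Data.List.Properties using (∷-injective; length-++; ++-assoc; ++-identityʳ; length-take; take++drop≡id; length-map; map-∘; map-cong; map-id)
open import Data.Product using (∃-syntax; _×_; _,_; proj₁; proj₂)
open import Data.Sum using (_⊎_; inj₁; inj₂)
open import Function using (_∘_)
open import Function.Bundles using (Inverse; _↔_; _⇔_; mk⇔; Equivalence)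
open import Relation.Binary.PropositionalEquality using (_≡_; refl; sym; trans; cong; cong₂; subst; module ≡-Reasoning)

open Equivalence using (to; from)

DownClosed : (ℕ → Set) → Set
DownClosed P = ∀ {m n} → m ≤ n → P n → P m

module _ {B : Set} where

  ≤s-[] : {u : List B} → u ≤s [] → u ≡ []
  ≤s-[] {[]}    _      = refl
  ≤s-[] {_ ∷ _} (_ , ())

  ≤s-⋆ : (u' u : List B) {b : B} → u' ≤s (u ⋆ b) → u' ≤s u ⊎ u' ≡ u ⋆ b
  ≤s-⋆ []            u       _        = inj₁ (u , refl)
  ≤s-⋆ (x ∷ [])      []      (_ , e)  = inj₂ (cong [_] (proj₁ (∷-injective e)))
  ≤s-⋆ (x ∷ y ∷ u')  []      (_ , ())
  ≤s-⋆ (x ∷ u')      (y ∷ u) (w , e) with ∷-injective e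
  ... | refl , e' with ≤s-⋆ u' u (w , e')
  ...   | inj₁ (w' , e'') = inj₁ (w' , cong (x ∷_) e'')
  ...   | inj₂ eq         = inj₂ (cong (x ∷_) eq)

  ≤s-trans : {u v w : List B} → u ≤s v → v ≤s w → u ≤s w
  ≤s-trans {u} (x , refl) (y , refl) = x ++ y , sym (++-assoc u x y)

  ⋆-++ : (u : List B) (b : B) (v : List B) → (u ⋆ b) ++ v ≡ u ++ (b ∷ v)
  ⋆-++ u b v = ++-assoc u [ b ] v

  length-⋆ : (u : List B) (b : B) → length (u ⋆ b) ≡ suc (length u)
  length-⋆ u b = trans (length-++ u) (+-comm (length u) 1)

  module _ {T : List B → Set} where

    ↓-prefix : {u v : List B} → u ≤s v → (T ↓) v → (T ↓) u
    ↓-prefix u≤v d u' u'≤u = d u' (≤s-trans u'≤u u≤v)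

    ↓-[] : T [] → (T ↓) []
    ↓-[] t u' u'≤[] = subst T (sym (≤s-[] u'≤[])) t

    ↓-⋆ : {u : List B} {b : B} → (T ↓) u → T (u ⋆ b) → (T ↓) (u ⋆ b)
    ↓-⋆ {u} d t u' u'≤ with ≤s-⋆ u' u u'≤
    ... | inj₁ u'≤u = d u' u'≤u
    ... | inj₂ refl = t

    ↑-⋆ : {u : List B} {b : B} → (T ↑) (u ⋆ b) → (T ↑) u ⊎ T (u ⋆ b)
    ↑-⋆ {u} (u' , u'≤ , t) with ≤s-⋆ u' u u'≤
    ... | inj₁ u'≤u = inj₁ (u' , u'≤u , t)
    ... | inj₂ refl = inj₂ t

    ↑-[] : (T ↑) [] → T []
    ↑-[] (u' , u'≤[] , t) = subst T (≤s-[] u'≤[]) t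

    pruning-paths : {X : List B → Set} → PruneClosed T X → X [] →
                    ∀ n → ∃[ u ] (length u ≡ n × X u × (T ↓) u)
    pruning-paths cl x₀ zero = [] , refl , x₀ , ↓-[] (proj₁ (cl [] x₀))
    pruning-paths cl x₀ (suc n) with pruning-paths cl x₀ n
    ... | u , refl , xu , du with cl u xu
    ...   | _ , b , xub = u ⋆ b , length-⋆ u b , xub , ↓-⋆ du (proj₁ (cl (u ⋆ b) xub))

    productive⇒unboundedPaths : Productive T → UnboundedPaths T
    productive⇒unboundedPaths (X , cl , x₀) n with pruning-paths cl x₀ n
    ... | u , len , _ , du = u , len , du

    BarredAt : List B → ℕ → Set
    BarredAt u n = ∀ v → length v ≡ n → (T ↑) (u ++ v)

    barredAt-⋆ : {u : List B} {n : ℕ} → (∀ b → BarredAt (u ⋆ b) n) → BarredAt u (suc n)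
    barredAt-⋆ {u} h (b ∷ v) refl = subst (T ↑) (⋆-++ u b v) (h b v refl)

    barredAt-suc : {u : List B} {n : ℕ} → BarredAt u (suc n) → ∀ b → BarredAt (u ⋆ b) n
    barredAt-suc {u} h b v refl = subst (T ↑) (sym (⋆-++ u b v)) (h (b ∷ v) refl)

    Extendable : List B → ℕ → Set
    Extendable u n = ∃[ v ] (length v ≡ n × (T ↓) (u ++ v))

    extendable⇒T : {u : List B} {n : ℕ} → Extendable u n → T u
    extendable⇒T (v , _ , d) = d _ (v , refl)

    extendable-⋆ : {u : List B} {n : ℕ} → Extendable u (suc n) → ∃[ b ] Extendable (u ⋆ b) n
    extendable-⋆ {u} (b ∷ v , len , d) = b , v , cong pred len , subst (T ↓) (sym (⋆-++ u b v)) d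

    extendable-≤ : {u : List B} {m n : ℕ} → m ≤ n → Extendable u n → Extendable u m
    extendable-≤ {u} {m} m≤n (v , refl , d) =
      take m v , trans (length-take m v) (m≤n⇒m⊓n≡m m≤n) , ↓-prefix prefix d
      where
      prefix : (u ++ take m v) ≤s (u ++ v)
      prefix = drop m v , trans (++-assoc u (take m v) (drop m v)) (cong (u ++_) (take++drop≡id m v))

  prefixForm : (List B → List B) → List B → Form {B}
  prefixForm f []      = atom (f [])
  prefixForm f (b ∷ w) = atom (f []) ∧f prefixForm (f ∘ (b ∷_)) w

  ⋁ : ∀ {n} → (Fin n → Form {B}) → Form {B}
  ⋁ {zero}  f = ⊥f
  ⋁ {suc n} f = f zero ∨f ⋁ (f ∘ suc)

  module _ {T : List B → Set} where

    prefixForm-sound : ∀ f w → ⟦ prefixForm f w ⟧ T → ∀ w' → w' ≤s w → T (f w')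
    prefixForm-sound f []      t       []        _        = t
    prefixForm-sound f []      _       (_ ∷ _)   (_ , ())
    prefixForm-sound f (b ∷ w) (t , _) []        _        = t
    prefixForm-sound f (b ∷ w) (_ , r) (c ∷ w')  (x , e) with ∷-injective e
    ... | refl , e' = prefixForm-sound (f ∘ (b ∷_)) w r w' (x , e')

    prefixForm-complete : ∀ f w → (∀ w' → w' ≤s w → T (f w')) → ⟦ prefixForm f w ⟧ T
    prefixForm-complete f []      h = h [] ([] , refl)
    prefixForm-complete f (b ∷ w) h =
      h [] (b ∷ w , refl) ,
      prefixForm-complete (f ∘ (b ∷_)) w (λ w' (x , e) → h (b ∷ w') (x , cong (b ∷_) e))

    ⟦prefixForm⟧⇔↓ : (u : List B) → ⟦ prefixForm (λ w → w) u ⟧ T ⇔ (T ↓) u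
    ⟦prefixForm⟧⇔↓ u = mk⇔ (prefixForm-sound (λ w → w) u) (prefixForm-complete (λ w → w) u)

    ⋁-elim : ∀ {n} (f : Fin n → Form {B}) → ⟦ ⋁ f ⟧ T → ∃[ i ] ⟦ f i ⟧ T
    ⋁-elim {suc n} f (inj₁ t) = zero , t
    ⋁-elim {suc n} f (inj₂ t) with ⋁-elim (f ∘ suc) t
    ... | i , t' = suc i , t'

    ⋁-intro : ∀ {n} (f : Fin n → Form {B}) i → ⟦ f i ⟧ T → ⟦ ⋁ f ⟧ T
    ⋁-intro f zero    t = inj₁ t
    ⋁-intro f (suc i) t = inj₂ (⋁-intro (f ∘ suc) i t)

    -- D for n formulas, from D for two, by induction on n: the last n are
    -- merged into one Σ⁰₁ formula, and down-closure lets one argument x ⊔ y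
    -- serve both variables of D's hypothesis.
    D-Σ₁⇒D-Fin : D-Σ₁ T → ∀ {n} (φ : Fin n → ℕ → ℕ → Form {B}) →
                 (∀ i → DownClosed (Σ₁ T (φ i))) →
                 (∀ m → ∃[ i ] Σ₁ T (φ i) m) → ∃[ i ] (∀ m → Σ₁ T (φ i) m)
    D-Σ₁⇒D-Fin D {zero} φ down h with h 0
    ... | () , _
    D-Σ₁⇒D-Fin D {suc n} φ down h with D (φ zero) rest split
      where
      rest : ℕ → ℕ → Form {B}
      rest y z = ⋁ (λ i → φ (suc i) y z)
      split : ∀ x y → Σ₁ T (φ zero) x ⊎ Σ₁ T rest y
      split x y with h (x ⊔ y)
      ... | zero , s  = inj₁ (down zero (m≤m⊔n x y) s)
      ... | suc i , s with down (suc i) (m≤n⊔m x y) s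
      ...   | z , t = inj₂ (z , ⋁-intro (λ j → φ (suc j) y z) i t)
    ... | inj₁ all₀ = zero , all₀
    ... | inj₂ allRest with D-Σ₁⇒D-Fin D (φ ∘ suc) (down ∘ suc) someRest
      where
      someRest : ∀ m → ∃[ i ] Σ₁ T (φ (suc i)) m
      someRest m with allRest m
      ... | z , t with ⋁-elim (λ j → φ (suc j) m z) t
      ...   | i , t' = i , z , t'
    ... | i , all = suc i , all

Eventually : (ℕ → Set) → Set
Eventually P = ∃[ n ] (∀ m → n ≤ m → P m)

eventually-pred : {P : ℕ → Set} → Eventually (P ∘ suc) → Eventually P
eventually-pred (n , h) = suc n , λ { (suc m) (s≤s n≤m) → h m n≤m }

eventually-∀ : ∀ {n} {P : Fin n → ℕ → Set} → (∀ i → Eventually (P i)) → Eventually (λ m → ∀ i → P i m)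
eventually-∀ {zero}      _  = 0 , λ _ _ ()
eventually-∀ {suc n} {P} ev with ev zero | eventually-∀ {P = P ∘ suc} (ev ∘ suc)
... | n₀ , h₀ | n₁ , h₁ =
  n₀ ⊔ n₁ , λ m le → ∀-cons {P = λ i → P i m}
                       (h₀ m (≤-trans (m≤m⊔n n₀ n₁) le)) (h₁ m (≤-trans (m≤n⊔m n₀ n₁) le))

∀-⊎-const : ∀ {n} {A : Fin n → Set} {C : Set} → (∀ i → A i ⊎ C) → (∀ i → A i) ⊎ C
∀-⊎-const {zero}      f = inj₁ λ ()
∀-⊎-const {suc n} {A} f with f zero | ∀-⊎-const {A = A ∘ suc} (f ∘ suc)
... | inj₂ c | _      = inj₂ c
... | inj₁ _ | inj₂ c = inj₂ c
... | inj₁ a | inj₁ g = inj₁ (∀-cons {P = A} a g)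

module Digits (k : ℕ) .{{_ : NonZero k}} where

  digits : ℕ → ℕ → List (Fin k)
  digits zero    y = []
  digits (suc m) y = fromℕ< (m%n<n y k) ∷ digits m (y / k)

  length-digits : ∀ m y → length (digits m y) ≡ m
  length-digits zero    y = refl
  length-digits (suc m) y = cong suc (length-digits m (y / k))

  digits-surjective : (v : List (Fin k)) → ∃[ y ] digits (length v) y ≡ v
  digits-surjective []      = 0 , refl
  digits-surjective (i ∷ v) with digits-surjective v
  ... | e , digits-e≡v = y , cong₂ _∷_ lowDigit (trans (cong (digits (length v)) quotient) digits-e≡v)
    where
    y = toℕ i + e * k
    lowDigit : fromℕ< (m%n<n y k) ≡ i
    lowDigit = trans (fromℕ<-cong _ _ (trans ([m+kn]%n≡m%n (toℕ i) e k) (m<n⇒m%n≡m (toℕ<n i))) _ (toℕ<n i))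
                     (fromℕ<-toℕ i (toℕ<n i))
    quotient : y / k ≡ e
    quotient = trans (+-distrib-/-∣ʳ (toℕ i) (divides e refl))
                     (cong₂ _+_ (m<n⇒m/n≡0 (toℕ<n i)) (m*n/n≡m e k))

module Finite {B : Set} (p : ℕ) (I : B ↔ Fin (suc p)) (T : List B → Set) where

  open Inverse I using () renaming (to to index; from to element; strictlyInverseʳ to element-index)
  open Digits (suc p)

  ∀-element : {P : B → Set} → (∀ i → P (element i)) → ∀ b → P b
  ∀-element {P} h b = subst P (element-index b) (h (index b))

  herClosure⇒eventuallyBarred : {u : List B} → HerClosure T u → Eventually (BarredAt {T = T} u)
  herClosure⇒eventuallyBarred {u} (base t) = 0 , λ _ _ v _ → u , (v , refl) , t
  herClosure⇒eventuallyBarred {u} (step f) with eventually-∀ (herClosure⇒eventuallyBarred ∘ f ∘ element)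
  ... | n , h = eventually-pred (n , λ m n≤m → barredAt-⋆ (∀-element (h m n≤m)))

  barredAt⇒herClosure⊎↑ : ∀ n {u} → BarredAt {T = T} u n → HerClosure T u ⊎ (T ↑) u
  barredAt⇒herClosure⊎↑ zero    {u} h = inj₂ (subst (T ↑) (++-identityʳ u) (h [] refl))
  barredAt⇒herClosure⊎↑ (suc n) {u} h with ∀-⊎-const childOrHere
    where
    childOrHere : ∀ i → HerClosure T (u ⋆ element i) ⊎ (T ↑) u
    childOrHere i with barredAt⇒herClosure⊎↑ n (barredAt-suc h (element i))
    ... | inj₁ hc = inj₁ hc
    ... | inj₂ ↑ub with ↑-⋆ ↑ub
    ...   | inj₁ ↑u = inj₂ ↑u
    ...   | inj₂ t  = inj₁ (base t)
  ... | inj₁ children = inj₁ (step (∀-element children))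
  ... | inj₂ ↑u       = inj₂ ↑u

  inductivelyBarred⇔uniformlyBarred : InductivelyBarred T ⇔ UniformlyBarred T
  inductivelyBarred⇔uniformlyBarred = mk⇔ ib⇒ub ub⇒ib
    where
    ib⇒ub : InductivelyBarred T → UniformlyBarred T
    ib⇒ub hc with herClosure⇒eventuallyBarred hc
    ... | n , h = n , h n ≤-refl
    ub⇒ib : UniformlyBarred T → InductivelyBarred T
    ub⇒ib (n , h) with barredAt⇒herClosure⊎↑ n h
    ... | inj₁ hc = hc
    ... | inj₂ ↑[] = base (↑-[] ↑[])

  word : ℕ → ℕ → List B
  word m y = map element (digits m y)

  length-word : ∀ m y → length (word m y) ≡ m
  length-word m y = trans (length-map element (digits m y)) (length-digits m y)

  word-surjective : (v : List B) → ∃[ y ] word (length v) y ≡ v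
  word-surjective v with digits-surjective (map index v)
  ... | y , digits≡ = y , (begin
      map element (digits (length v) y)           ≡⟨ cong (map element ∘ (λ m → digits m y)) (sym (length-map index v)) ⟩
      map element (digits (length (map index v)) y) ≡⟨ cong (map element) digits≡ ⟩
      map element (map index v)                    ≡⟨ sym (map-∘ v) ⟩
      map (element ∘ index) v                      ≡⟨ map-cong element-index v ⟩
      map (λ b → b) v                              ≡⟨ map-id v ⟩
      v                                            ∎)
    where open ≡-Reasoning

  extendableForm : List B → ℕ → ℕ → Form {B}
  extendableForm u n y = prefixForm (λ w → w) (u ++ word n y)

  Σ₁-extendable⇔ : ∀ u n → Σ₁ T (extendableForm u) n ⇔ Extendable {T = T} u n
  Σ₁-extendable⇔ u n = mk⇔ sound complete
    where
    sound : Σ₁ T (extendableForm u) n → Extendable u n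
    sound (y , t) = word n y , length-word n y , to (⟦prefixForm⟧⇔↓ (u ++ word n y)) t
    complete : Extendable u n → Σ₁ T (extendableForm u) n
    complete (v , refl , d) with word-surjective v
    ... | y , word≡v = y , from (⟦prefixForm⟧⇔↓ (u ++ word (length v) y))
                                 (subst (λ w → (T ↓) (u ++ w)) (sym word≡v) d)

  Unbounded : List B → Set
  Unbounded u = ∀ n → Extendable {T = T} u n

  unbounded-child : D-Σ₁ T → {u : List B} → Unbounded u → ∃[ b ] Unbounded (u ⋆ b)
  unbounded-child D {u} unb with D-Σ₁⇒D-Fin D (extendableForm ∘ child) down someChild
    where
    child : Fin (suc p) → List B
    child i = u ⋆ element i
    down : ∀ i → DownClosed (Σ₁ T (extendableForm (child i)))
    down i {m} {n} m≤n =
      from (Σ₁-extendable⇔ (child i) m) ∘ extendable-≤ m≤n ∘ to (Σ₁-extendable⇔ (child i) n)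
    someChild : ∀ m → ∃[ i ] Σ₁ T (extendableForm (child i)) m
    someChild m with extendable-⋆ (unb (suc m))
    ... | b , ext = index b , from (Σ₁-extendable⇔ (child (index b)) m)
                                (subst (λ c → Extendable (u ⋆ c) m) (sym (element-index b)) ext)
  ... | i , all = element i , λ m → to (Σ₁-extendable⇔ (u ⋆ element i) m) (all m)

  unboundedPaths⇒productive : D-Σ₁ T → UnboundedPaths T → Productive T
  unboundedPaths⇒productive D paths =
    Unbounded , (λ u unb → extendable⇒T (unb 0) , unbounded-child D unb) , paths

proposition6 : {B : Set} (p : ℕ) → B ↔ Fin (suc p) → (T : List B → Set) →
    (D-Σ₁ T → (Productive T ⇔ UnboundedPaths T))
      × (C-Σ₁ T → (InductivelyBarred T ⇔ UniformlyBarred T))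
proposition6 p I T =
  (λ D → mk⇔ productive⇒unboundedPaths (unboundedPaths⇒productive D)) ,
  (λ _ → inductivelyBarred⇔uniformlyBarred)
  where open Finite p I T
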